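{- Let $A,\Sigma$ be finite alphabets with $|A|\ge|\Sigma|\ge2$, $K$ a commutative ring with unity, and $\phi$ a map from $A$ onto $\Sigma$, extended to a monoid morphism $A^*\to\Sigma^*$ and then to a $K$-algebra homomorphism $\phi:K\langle A\rangle\to K\langle\Sigma\rangle$. (i) $\phi\circ l_A^*=l_\Sigma^*\circ\phi$ as maps $K\langle A\rangle\to K\langle\Sigma\rangle$, and $\phi(\ker l_A^*)\subseteq\ker l_\Sigma^*$. (ii) If $|A|=|\Sigma|$ then $\phi$ maps $\ker l_A^*$ bijectively onto $\ker l_\Sigma^*$. (iii) $\phi(\ker l_A^*)=\ker l_\Sigma^*$; and if $|A|>|\Sigma|$ then $\ker l_A^*$ is a proper subset of $\phi^{ -1}(\ker l_\Sigma^*)$.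
   Context: For a finite alphabet $X$, $K\langle X\rangle$ is the free associative algebra with scalar product $(P,Q)=\sum_w(P,w)(Q,w)$. The left normed bracketing: $l(\epsilon)=0$, $l(a)=a$, $l(ua)=l(u)a-a\,l(u)$, extended linearly; $l_X^*$ is the $K$-linear endomorphism of $K\langle X\rangle$ with $(l_X^*(u),v)=(l(v),u)$ for all words $u,v$ over $X$ (equivalently $l_X^*(\epsilon)=0$, $l_X^*(a)=a$, $l_X^*(aub)=l_X^*(au)b-l_X^*(ub)a$). -}

module Defs where

open import Level using (_⊔_)
open import Algebra.Bundles using (CommutativeRing)
open import Data.Nat using (ℕ; zero; suc)
open import Data.Fin using (Fin)
import Data.Fin.Properties as FinP
open import Data.List using (List; []; _∷_; _++_; [_]; map; concatMap; length)
import Data.List.Properties as ListP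
open import Data.Product using (_×_; _,_)
open import Relation.Nullary using (yes; no)

Word : ℕ → Set
Word n = List (Fin n)

-- Elements of the free associative algebra K⟨Fin n⟩, represented as finite
-- formal sums  Σ cᵢ wᵢ  (lists of coefficient/word pairs), compared
-- coefficientwise (see _≈P_ below).
module FreeAlg {c ℓ} (K : CommutativeRing c ℓ) (n : ℕ) where
  open CommutativeRing K

  Poly : Set c
  Poly = List (Carrier × Word n)

  0P : Poly
  0P = []

  mono : Word n → Poly
  mono w = [ (1# , w) ]

  _+P_ : Poly → Poly → Poly
  P +P Q = P ++ Q

  scale : Carrier → Poly → Poly
  scale k = map (λ { (a , w) → (k * a , w) })

  -P_ : Poly → Poly
  -P P = map (λ { (a , w) → (- a , w) }) P

  _-P_ : Poly → Poly → Poly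
  P -P Q = P +P (-P Q)

  _·ₗ_ : Poly → Fin n → Poly
  P ·ₗ b = map (λ { (a , w) → (a , w ++ [ b ]) }) P

  coeff : Poly → Word n → Carrier
  coeff [] w = 0#
  coeff ((a , u) ∷ P) w with ListP.≡-dec FinP._≟_ u w
  ... | yes _ = a + coeff P w
  ... | no  _ = coeff P w

  _≈P_ : Poly → Poly → Set ℓ
  P ≈P Q = ∀ (w : Word n) → coeff P w ≈ coeff Q w

  -- l*(ε) = 0, l*(a) = a, l*(a u b) = l*(a u) b − l*(u b) a.
  -- Fuel-driven recursion (fuel = length of the word); `lstarW` uses
  -- exactly enough fuel.
  unsnoc : Fin n → Word n → Word n × Fin n
  unsnoc x []      = ([] , x)
  unsnoc x (y ∷ w) with unsnoc y w
  ... | (u , b) = (x ∷ u , b)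

  lstarF : ℕ → Word n → Poly
  lstarF zero    _            = 0P
  lstarF (suc k) []           = 0P
  lstarF (suc k) (a ∷ [])     = mono (a ∷ [])
  lstarF (suc k) (a ∷ x ∷ w)  with unsnoc x w
  ... | (u , b) = (lstarF k (a ∷ u) ·ₗ b) -P (lstarF k (u ++ [ b ]) ·ₗ a)

  lstarW : Word n → Poly
  lstarW w = lstarF (length w) w

  lstar : Poly → Poly
  lstar = concatMap (λ { (a , w) → scale a (lstarW w) })

  InKer : Poly → Set ℓ
  InKer P = lstar P ≈P 0P

mapPoly : ∀ {c ℓ} (K : CommutativeRing c ℓ) {n m : ℕ} → (Fin n → Fin m) →
          FreeAlg.Poly K n → FreeAlg.Poly K m
mapPoly K φ = map (λ { (a , w) → (a , map φ w) })

-- Since φ acts letterwise, it commutes with the recursion defining l*, and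
-- a coefficient of φ(P) is a sum of coefficients of P, so φ maps ker l*_A
-- into ker l*_Σ.  A section σ of φ maps ker l*_Σ into ker l*_A with
-- φ ∘ σ = id, giving surjectivity.  When |A| = |Σ| the surjection φ is a
-- bijection, hence injective on words and on polynomials.  When |A| > |Σ|
-- two distinct letters a, b have the same image, and a − b lies in
-- φ⁻¹(ker l*_Σ) but not in ker l*_A, since l*(a − b) = a − b.
module Submission where

open import Defs
open import Algebra.Bundles using (CommutativeRing)
open import Data.Nat using (ℕ; zero; suc; _≤_; _<_; z≤n; s≤s)
import Data.Nat.Properties as ℕP
open import Data.Fin using (Fin; punchOut)
open import Data.Fin.Properties using (_≟_; pigeonhole; punchOut-injective; injective⇒≤; <⇒≢)
open import Data.List using ([]; _∷_; _++_; [_]; map; length)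
import Data.List.Properties as ListP
open import Data.Product using (_×_; Σ; ∃; _,_; proj₁; proj₂)
import Data.Product as Product
open import Function using (_∘_)
open import Function.Definitions using (Injective)
open import Relation.Nullary using (¬_; yes; no; Dec; contradiction)
open import Relation.Binary.PropositionalEquality
  using (_≡_; _≢_; refl; sym; trans; cong; cong₂; subst; module ≡-Reasoning)

_≟W_ : ∀ {n} (u v : Word n) → Dec (u ≡ v)
_≟W_ = ListP.≡-dec _≟_

section⇒endo-injective : ∀ {n} {φ σ : Fin n → Fin n} → (∀ s → φ (σ s) ≡ s) →
                         Injective _≡_ _≡_ φ
section⇒endo-injective {zero} _ {x = ()}
section⇒endo-injective {suc k} {φ} {σ} φσ {i} {j} φi≡φj with i ≟ j
... | yes i≡j = i≡j
... | no i≢j = contradiction (injective⇒≤ punchOut-σ′-injective) ℕP.1+n≰n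
  where
  -- Redirecting σ from j to i yields a section of φ missing j, hence an
  -- injection Fin (suc k) → Fin k.
  σ′ : Fin (suc k) → Fin (suc k)
  σ′ s with σ s ≟ j
  ... | yes _ = i
  ... | no _  = σ s

  φσ′ : ∀ s → φ (σ′ s) ≡ s
  φσ′ s with σ s ≟ j
  ... | yes σs≡j = trans φi≡φj (trans (cong φ (sym σs≡j)) (φσ s))
  ... | no _     = φσ s

  j≢σ′ : ∀ s → j ≢ σ′ s
  j≢σ′ s with σ s ≟ j
  ... | yes _    = i≢j ∘ sym
  ... | no σs≢j = σs≢j ∘ sym

  punchOut-σ′-injective : Injective _≡_ _≡_ (λ s → punchOut (j≢σ′ s))
  punchOut-σ′-injective {s} {t} eq = begin
    s          ≡⟨ sym (φσ′ s) ⟩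
    φ (σ′ s)   ≡⟨ cong φ (punchOut-injective (j≢σ′ s) (j≢σ′ t) eq) ⟩
    φ (σ′ t)   ≡⟨ φσ′ t ⟩
    t          ∎
    where open ≡-Reasoning

module _ {c ℓ} (K : CommutativeRing c ℓ) where
  open CommutativeRing K using (Carrier; _+_; _*_; -_; 0#; 1#; _≈_)

  indicator : ∀ {p} {P : Set p} → Dec P → Carrier
  indicator (yes _) = 1#
  indicator (no _)  = 0#

  module _ {n m : ℕ} (φ : Fin n → Fin m) where
    private
      module A = FreeAlg K n
      module B = FreeAlg K m

      φ* : A.Poly → B.Poly
      φ* = mapPoly K φ

    unsnoc-map : ∀ x w → B.unsnoc (φ x) (map φ w) ≡ Product.map (map φ) φ (A.unsnoc x w)
    unsnoc-map x []      = refl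
    unsnoc-map x (y ∷ w) = cong (λ (u , b) → (φ x ∷ u , b)) (unsnoc-map y w)

    mapPoly-·ₗ : ∀ P b → φ* (P A.·ₗ b) ≡ φ* P B.·ₗ φ b
    mapPoly-·ₗ []            b = refl
    mapPoly-·ₗ ((a , w) ∷ P) b = cong₂ _∷_ (cong (a ,_) (ListP.map-++ φ w [ b ])) (mapPoly-·ₗ P b)

    mapPoly--P : ∀ P → φ* (A.-P P) ≡ B.-P φ* P
    mapPoly--P []      = refl
    mapPoly--P (_ ∷ P) = cong (_ ∷_) (mapPoly--P P)

    mapPoly-scale : ∀ k P → φ* (A.scale k P) ≡ B.scale k (φ* P)
    mapPoly-scale k []      = refl
    mapPoly-scale k (_ ∷ P) = cong (_ ∷_) (mapPoly-scale k P)

    mapPoly-lstarF : ∀ k w → φ* (A.lstarF k w) ≡ B.lstarF k (map φ w)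
    mapPoly-lstarF zero    w           = refl
    mapPoly-lstarF (suc k) []          = refl
    mapPoly-lstarF (suc k) (a ∷ [])    = refl
    mapPoly-lstarF (suc k) (a ∷ x ∷ w) rewrite unsnoc-map x w = begin
      φ* ((A.lstarF k (a ∷ u) A.·ₗ b) A.-P (A.lstarF k (u ++ [ b ]) A.·ₗ a))
        ≡⟨ ListP.map-++ _ (A.lstarF k (a ∷ u) A.·ₗ b) _ ⟩
      φ* (A.lstarF k (a ∷ u) A.·ₗ b) ++ φ* (A.-P (A.lstarF k (u ++ [ b ]) A.·ₗ a))
        ≡⟨ cong₂ _++_ (mapPoly-·ₗ (A.lstarF k (a ∷ u)) b)
                      (trans (mapPoly--P _) (cong B.-P_ (mapPoly-·ₗ (A.lstarF k (u ++ [ b ])) a))) ⟩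
      (φ* (A.lstarF k (a ∷ u)) B.·ₗ φ b) B.-P (φ* (A.lstarF k (u ++ [ b ])) B.·ₗ φ a)
        ≡⟨ cong₂ (λ P Q → (P B.·ₗ φ b) B.-P (Q B.·ₗ φ a))
                 (mapPoly-lstarF k (a ∷ u))
                 (trans (mapPoly-lstarF k (u ++ [ b ])) (cong (B.lstarF k) (ListP.map-++ φ u [ b ]))) ⟩
      (B.lstarF k (φ a ∷ map φ u) B.·ₗ φ b) B.-P (B.lstarF k (map φ u ++ [ φ b ]) B.·ₗ φ a) ∎
      where
      open ≡-Reasoning
      u = proj₁ (A.unsnoc x w)
      b = proj₂ (A.unsnoc x w)

    mapPoly-lstarW : ∀ w → φ* (A.lstarW w) ≡ B.lstarW (map φ w)
    mapPoly-lstarW w rewrite ListP.length-map φ w = mapPoly-lstarF (length w) w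

    mapPoly-lstar : ∀ P → φ* (A.lstar P) ≡ B.lstar (φ* P)
    mapPoly-lstar []            = refl
    mapPoly-lstar ((a , w) ∷ P) =
      trans (ListP.map-++ _ (A.scale a (A.lstarW w)) (A.lstar P))
            (cong₂ _++_ (trans (mapPoly-scale a _) (cong (B.scale a) (mapPoly-lstarW w)))
                        (mapPoly-lstar P))

  module _ {n : ℕ} where
    open FreeAlg K n
    open CommutativeRing K using (setoid; +-cong; +-congˡ; +-congʳ; +-assoc; +-comm;
      +-identityʳ; distribʳ; zeroˡ; *-congʳ; *-identityʳ; -‿inverseʳ)
      renaming (refl to ≈-refl; sym to ≈-sym; trans to ≈-trans; reflexive to ≈-reflexive)
    open import Relation.Binary.Reasoning.Setoid setoid

    ≡⇒≈P : ∀ {P Q} → P ≡ Q → P ≈P Q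
    ≡⇒≈P P≡Q w = ≈-reflexive (cong (λ R → coeff R w) P≡Q)

    linearExtension : (Word n → Carrier) → Poly → Carrier
    linearExtension g []            = 0#
    linearExtension g ((a , v) ∷ Q) = a * g v + linearExtension g Q

    removeWord : Word n → Poly → Poly
    removeWord v [] = []
    removeWord v ((a , u) ∷ Q) with u ≟W v
    ... | yes _ = removeWord v Q
    ... | no _  = (a , u) ∷ removeWord v Q

    linearExtension-removeWord : ∀ g v Q →
      linearExtension g Q ≈ coeff Q v * g v + linearExtension g (removeWord v Q)
    linearExtension-removeWord g v [] = ≈-sym (≈-trans (+-identityʳ _) (zeroˡ _))
    linearExtension-removeWord g v ((a , u) ∷ Q) with u ≟W v
    ... | yes refl = begin
      a * g u + linearExtension g Q
        ≈⟨ +-congˡ (linearExtension-removeWord g v Q) ⟩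
      a * g u + (coeff Q v * g v + linearExtension g (removeWord v Q))
        ≈⟨ +-assoc _ _ _ ⟨
      (a * g u + coeff Q v * g v) + linearExtension g (removeWord v Q)
        ≈⟨ +-congʳ (distribʳ _ _ _) ⟨
      (a + coeff Q v) * g v + linearExtension g (removeWord v Q) ∎
    ... | no _ = begin
      a * g u + linearExtension g Q
        ≈⟨ +-congˡ (linearExtension-removeWord g v Q) ⟩
      a * g u + (coeff Q v * g v + linearExtension g (removeWord v Q))
        ≈⟨ +-assoc _ _ _ ⟨
      (a * g u + coeff Q v * g v) + linearExtension g (removeWord v Q)
        ≈⟨ +-congʳ (+-comm _ _) ⟩
      (coeff Q v * g v + a * g u) + linearExtension g (removeWord v Q)
        ≈⟨ +-assoc _ _ _ ⟩
      coeff Q v * g v + (a * g u + linearExtension g (removeWord v Q)) ∎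

    coeff-removeWord-≢ : ∀ {v w} Q → v ≢ w → coeff (removeWord v Q) w ≈ coeff Q w
    coeff-removeWord-≢ [] _ = ≈-refl
    coeff-removeWord-≢ {v} {w} ((a , u) ∷ Q) v≢w with u ≟W v
    ... | yes refl with u ≟W w
    ...   | yes u≡w = contradiction u≡w v≢w
    ...   | no _    = coeff-removeWord-≢ Q v≢w
    coeff-removeWord-≢ {v} {w} ((a , u) ∷ Q) v≢w | no _ with u ≟W w
    ...   | yes _ = +-congˡ (coeff-removeWord-≢ Q v≢w)
    ...   | no _  = coeff-removeWord-≢ Q v≢w

    coeff-removeWord-≡ : ∀ v Q → coeff (removeWord v Q) v ≈ 0#
    coeff-removeWord-≡ v [] = ≈-refl
    coeff-removeWord-≡ v ((a , u) ∷ Q) with u ≟W v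
    ... | yes _ = coeff-removeWord-≡ v Q
    ... | no u≢v with u ≟W v
    ...   | yes u≡v = contradiction u≡v u≢v
    ...   | no _    = coeff-removeWord-≡ v Q

    length-removeWord : ∀ v Q → length (removeWord v Q) ≤ length Q
    length-removeWord v [] = z≤n
    length-removeWord v ((a , u) ∷ Q) with u ≟W v
    ... | yes _ = ℕP.m≤n⇒m≤1+n (length-removeWord v Q)
    ... | no _  = s≤s (length-removeWord v Q)

    length-removeWord-head : ∀ a v Q → length (removeWord v ((a , v) ∷ Q)) ≤ length Q
    length-removeWord-head a v Q with v ≟W v
    ... | yes _  = length-removeWord v Q
    ... | no v≢v = contradiction refl v≢v

    -- Removing all terms of one word keeps the polynomial zero and shortens
    -- it, so induction on the number of terms goes through.
    linearExtension-≈P0 : ∀ g Q → Q ≈P 0P → linearExtension g Q ≈ 0#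
    linearExtension-≈P0 g Q = go (length Q) Q ℕP.≤-refl
      where
      go : ∀ k Q → length Q ≤ k → Q ≈P 0P → linearExtension g Q ≈ 0#
      go k       []            _         _    = ≈-refl
      go (suc k) ((a , v) ∷ Q) (s≤s len) Q≈0 = begin
        linearExtension g ((a , v) ∷ Q)
          ≈⟨ linearExtension-removeWord g v ((a , v) ∷ Q) ⟩
        coeff ((a , v) ∷ Q) v * g v + linearExtension g Q′
          ≈⟨ +-cong (≈-trans (*-congʳ (Q≈0 v)) (zeroˡ _))
                    (go k Q′ (ℕP.≤-trans (length-removeWord-head a v Q) len) Q′≈0) ⟩
        0# + 0#
          ≈⟨ +-identityʳ _ ⟩
        0# ∎
        where
        Q′ = removeWord v ((a , v) ∷ Q)
        Q′≈0 : Q′ ≈P 0P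
        Q′≈0 w with v ≟W w
        ... | yes refl = coeff-removeWord-≡ v ((a , v) ∷ Q)
        ... | no v≢w   = ≈-trans (coeff-removeWord-≢ ((a , v) ∷ Q) v≢w) (Q≈0 w)

    letterDifference : Fin n → Fin n → Poly
    letterDifference a b = (1# , [ a ]) ∷ (- 1# , [ b ]) ∷ []

    letterDifference-InKer : ∀ x → InKer (letterDifference x x)
    letterDifference-InKer x w with [ x ] ≟W w
    ... | yes [x]≡w with [ x ] ≟W w
    ...   | yes _    = ≈-trans (+-congˡ (+-identityʳ _))
                         (≈-trans (+-cong (*-identityʳ 1#) (*-identityʳ (- 1#))) (-‿inverseʳ 1#))
    ...   | no [x]≢w = contradiction [x]≡w [x]≢w
    letterDifference-InKer x w | no [x]≢w with [ x ] ≟W w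
    ...   | yes [x]≡w = contradiction [x]≡w [x]≢w
    ...   | no _      = ≈-refl

    coeff-lstar-letterDifference : ∀ {a b} → a ≢ b → coeff (lstar (letterDifference a b)) [ a ] ≈ 1#
    coeff-lstar-letterDifference {a} {b} a≢b with [ a ] ≟W [ a ]
    ... | no ¬refl = contradiction refl ¬refl
    ... | yes _ with [ b ] ≟W [ a ]
    ...   | yes [b]≡[a] = contradiction (sym (ListP.∷-injectiveˡ [b]≡[a])) a≢b
    ...   | no _        = ≈-trans (+-identityʳ _) (*-identityʳ 1#)

  module _ {n m : ℕ} (φ : Fin n → Fin m) where
    private
      module A = FreeAlg K n
      module B = FreeAlg K m

      φ* : A.Poly → B.Poly
      φ* = mapPoly K φ
    open CommutativeRing K using (+-cong; +-congˡ; +-congʳ; +-identityˡ; *-identityʳ; zeroʳ)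
      renaming (refl to ≈-refl; sym to ≈-sym; trans to ≈-trans)

    coeff-mapPoly : ∀ w Q → B.coeff (φ* Q) w ≈ linearExtension (λ v → indicator (map φ v ≟W w)) Q
    coeff-mapPoly w [] = ≈-refl
    coeff-mapPoly w ((a , v) ∷ Q) with map φ v ≟W w
    ... | yes _ = +-cong (≈-sym (*-identityʳ a)) (coeff-mapPoly w Q)
    ... | no _  = ≈-trans (coeff-mapPoly w Q) (≈-sym (≈-trans (+-congʳ (zeroʳ a)) (+-identityˡ _)))

    mapPoly-≈P0 : ∀ Q → Q A.≈P A.0P → φ* Q B.≈P B.0P
    mapPoly-≈P0 Q Q≈0 w = ≈-trans (coeff-mapPoly w Q) (linearExtension-≈P0 _ Q Q≈0)

    mapPoly-InKer : ∀ P → A.InKer P → B.InKer (φ* P)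
    mapPoly-InKer P P∈ker w =
      ≈-trans (≡⇒≈P (sym (mapPoly-lstar φ P)) w) (mapPoly-≈P0 (A.lstar P) P∈ker w)

    coeff-mapPoly-map : Injective _≡_ _≡_ (map φ) → ∀ u P → B.coeff (φ* P) (map φ u) ≈ A.coeff P u
    coeff-mapPoly-map inj u [] = ≈-refl
    coeff-mapPoly-map inj u ((a , v) ∷ P) with map φ v ≟W map φ u | v ≟W u
    ... | yes _    | yes _   = +-congˡ (coeff-mapPoly-map inj u P)
    ... | no _     | no _    = coeff-mapPoly-map inj u P
    ... | yes φv≡φu | no v≢u = contradiction (inj φv≡φu) v≢u
    ... | no φv≢φu | yes v≡u = contradiction (cong (map φ) v≡u) φv≢φu

    mapPoly-injective : Injective _≡_ _≡_ φ → ∀ P Q → φ* P B.≈P φ* Q → P A.≈P Q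
    mapPoly-injective inj P Q φP≈φQ u = begin
      A.coeff P u              ≈⟨ coeff-mapPoly-map (ListP.map-injective inj) u P ⟨
      B.coeff (φ* P) (map φ u) ≈⟨ φP≈φQ (map φ u) ⟩
      B.coeff (φ* Q) (map φ u) ≈⟨ coeff-mapPoly-map (ListP.map-injective inj) u Q ⟩
      A.coeff Q u              ∎
      where open import Relation.Binary.Reasoning.Setoid (CommutativeRing.setoid K)

    mapPoly-section : ∀ {σ : Fin m → Fin n} → (∀ s → φ (σ s) ≡ s) → ∀ R → φ* (mapPoly K σ R) ≡ R
    mapPoly-section φσ []            = refl
    mapPoly-section φσ ((a , w) ∷ R) = cong₂ _∷_ (cong (a ,_) map-section) (mapPoly-section φσ R)
      where
      map-section : map φ (map _ w) ≡ w
      map-section = trans (sym (ListP.map-∘ w)) (trans (ListP.map-cong φσ w) (ListP.map-id w))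

lemma2p10 : ∀ {c ℓ} (K : CommutativeRing c ℓ) (n m : ℕ) (φ : Fin n → Fin m) →
    ¬ (CommutativeRing._≈_ K (CommutativeRing.1# K) (CommutativeRing.0# K)) →
    2 ≤ m → m ≤ n →
    (∀ (s : Fin m) → ∃ λ (a : Fin n) → φ a ≡ s) →
    ((∀ (P : FreeAlg.Poly K n) →
        FreeAlg._≈P_ K m (mapPoly K φ (FreeAlg.lstar K n P)) (FreeAlg.lstar K m (mapPoly K φ P)))
     × (∀ (P : FreeAlg.Poly K n) → FreeAlg.InKer K n P → FreeAlg.InKer K m (mapPoly K φ P)))
    × (n ≡ m →
        (∀ (P Q : FreeAlg.Poly K n) → FreeAlg.InKer K n P → FreeAlg.InKer K n Q →
           FreeAlg._≈P_ K m (mapPoly K φ P) (mapPoly K φ Q) → FreeAlg._≈P_ K n P Q)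
        × (∀ (R : FreeAlg.Poly K m) → FreeAlg.InKer K m R →
           Σ (FreeAlg.Poly K n) λ P → FreeAlg.InKer K n P × FreeAlg._≈P_ K m (mapPoly K φ P) R))
    × ((∀ (R : FreeAlg.Poly K m) → FreeAlg.InKer K m R →
          Σ (FreeAlg.Poly K n) λ P → FreeAlg.InKer K n P × FreeAlg._≈P_ K m (mapPoly K φ P) R)
       × (m < n →
          (∀ (P : FreeAlg.Poly K n) → FreeAlg.InKer K n P → FreeAlg.InKer K m (mapPoly K φ P))
          × (Σ (FreeAlg.Poly K n) λ P → FreeAlg.InKer K m (mapPoly K φ P) × ¬ FreeAlg.InKer K n P)))
lemma2p10 K n m φ 1≉0 _ _ surj =
  (naturality , mapPoly-InKer K φ) , bijective , (onto , λ m<n → mapPoly-InKer K φ , notInjective m<n)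
  where
  module A = FreeAlg K n
  module B = FreeAlg K m

  σ : Fin m → Fin n
  σ = proj₁ ∘ surj

  naturality : ∀ P → mapPoly K φ (A.lstar P) B.≈P B.lstar (mapPoly K φ P)
  naturality P = ≡⇒≈P K (mapPoly-lstar K φ P)

  onto : ∀ R → B.InKer R → Σ A.Poly λ P → A.InKer P × mapPoly K φ P B.≈P R
  onto R R∈ker =
    mapPoly K σ R , mapPoly-InKer K σ R R∈ker , ≡⇒≈P K (mapPoly-section K φ (proj₂ ∘ surj) R)

  bijective : n ≡ m →
    (∀ P Q → A.InKer P → A.InKer Q → mapPoly K φ P B.≈P mapPoly K φ Q → P A.≈P Q) ×
    (∀ R → B.InKer R → Σ A.Poly λ P → A.InKer P × mapPoly K φ P B.≈P R)
  bijective refl =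
    (λ P Q _ _ → mapPoly-injective K φ (section⇒endo-injective (proj₂ ∘ surj)) P Q) , onto

  notInjective : m < n → Σ A.Poly λ P → B.InKer (mapPoly K φ P) × ¬ A.InKer P
  notInjective m<n with a , b , a<b , φa≡φb ← pigeonhole m<n φ =
    letterDifference K a b ,
    subst (λ y → B.InKer (letterDifference K (φ a) y)) φa≡φb (letterDifference-InKer K (φ a)) ,
    λ a-b∈ker → 1≉0 (CommutativeRing.trans K
      (CommutativeRing.sym K (coeff-lstar-letterDifference K (<⇒≢ a<b))) (a-b∈ker [ a ]))
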